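{- Consider the algorithm described in the context, applied to a bipartite graph $G=(A\cup B,E)$ with $V_p\subseteq A$. Every augmenting $s$-$t$-path along which flow is increased in the while-loop of the algorithm is a price path, i.e., its first edge is $(s,v)$ for some priceable vertex $v\in V_p$.
   Context: Setting: bipartite graph $G=(A\cup B,E)$, $E\subseteq A\times B$, vertices partitioned into priceable $V_p\subseteq A$ (prices $p(v)\ge0$) and fixed-price $V_f$ (costs $c(v)\ge0$). The flow network $G_d$ adds a source $s$ with directed edges $(s,v)$ for all $v\in A$ and a sink $t$ with directed edges $(v,t)$ for all $v\in B$; edge $(s,v)$ or $(v,t)$ has capacity $p(v)$ if $v\in V_p$ and $c(v)$ if $v\in V_f$; original edges are directed from $A$ to $B$ with infinite capacity. An augmenting path (w.r.t. a flow) is a path traversing forward edges with slack capacity and backward edges with nonzero flow. An augmenting $s$-$t$-path starting with an edge $(s,v)$, $v\in V_p$, is a price path; one starting with $(s,v)$, $v\in V_f$, is a fixed path. Algorithm: (1) construct $G_d$; (2) set $p(v)=0$ for all $v\in V_p$; (3) compute a maximum $s$-$t$-flow $\phi$ in $G_d$; (4) while there is $v\in V_p$ such that increasing $p(v)$ yields an augmenting $s$-$t$-path $P$, increase $p(v)$ and $\phi$ along $P$ as much as possible.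
   Formalization: The prices $p(v)$, the costs $c(v)$, the flow $\phi$ and the amounts by which the while-loop increases prices and flow take values in the rationals. -}

module Defs where

open import Data.Bool using (Bool; true; false; if_then_else_; not; T)
open import Data.Nat using (ℕ; zero; suc)
open import Data.Fin using (Fin; zero; suc; _≟_)
open import Data.Rational using (ℚ; 0ℚ; 1ℚ; _+_; _*_; -_; _<_; _≤_)
open import Data.Product using (_×_)
open import Data.Empty using (⊥)
open import Relation.Nullary using (¬_)
open import Data.Unit using (⊤)
open import Data.List using (List; []; _∷_)
open import Data.List.Relation.Unary.Unique.Propositional using (Unique)
open import Relation.Nullary.Decidable using (⌊_⌋)
open import Relation.Binary.PropositionalEquality using (_≡_)

-- Problem instance: bipartite graph G = (A ∪ B, E), A = Fin nA, B = Fin nB.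
-- priceable i = true  iff  i ∈ V_p (V_p ⊆ A); every other vertex is in V_f.
-- costA i is the cost c(i) of a fixed-price vertex i ∈ A (only used when
-- i ∉ V_p); costB j is the cost c(j) of j ∈ B (all of B is fixed-price).

record Instance : Set where
  field
    nA nB      : ℕ
    edge       : Fin nA → Fin nB → Bool
    priceable  : Fin nA → Bool
    costA      : Fin nA → ℚ
    costB      : Fin nB → ℚ
    costA-nonneg : ∀ i → T (not (priceable i)) → 0ℚ ≤ costA i
    costB-nonneg : ∀ j → 0ℚ ≤ costB j

sumFin : (n : ℕ) → (Fin n → ℚ) → ℚ
sumFin zero    f = 0ℚ
sumFin (suc n) f = f zero + sumFin n (λ k → f (suc k))

module _ (G : Instance) where
  open Instance G

  data Node : Set where
    s t : Node
    a   : Fin nA → Node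
    b   : Fin nB → Node

  data Edge : Node → Node → Set where
    sa : (i : Fin nA) → Edge s (a i)
    ab : (i : Fin nA) (j : Fin nB) → T (edge i j) → Edge (a i) (b j)
    bt : (j : Fin nB) → Edge (b j) t

  -- Prices p : Fin nA → ℚ (only the values on V_p are relevant).
  Prices : Set
  Prices = Fin nA → ℚ

  zeroPrices : Prices
  zeroPrices _ = 0ℚ

  raise : Prices → Fin nA → ℚ → Prices
  raise p v δ i = if ⌊ i ≟ v ⌋ then p v + δ else p i

  -- capacity of (s,i): p(i) if i ∈ V_p, c(i) otherwise.
  -- capacity of (j,t): c(j).  Edges A → B have infinite capacity.
  capA : Prices → Fin nA → ℚ
  capA p i = if priceable i then p i else costA i

  record Flow : Set where
    field
      fs : Fin nA → ℚ
      fm : Fin nA → Fin nB → ℚ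
      ft : Fin nB → ℚ
  open Flow public

  flowOn : Flow → ∀ {x y} → Edge x y → ℚ
  flowOn φ (sa i)     = fs φ i
  flowOn φ (ab i j _) = fm φ i j
  flowOn φ (bt j)     = ft φ j

  record Feasible (p : Prices) (φ : Flow) : Set where
    field
      fs-nonneg : ∀ i → 0ℚ ≤ fs φ i
      fs-cap    : ∀ i → fs φ i ≤ capA p i
      fm-nonneg : ∀ i j → 0ℚ ≤ fm φ i j
      fm-nonedge : ∀ i j → T (not (edge i j)) → fm φ i j ≡ 0ℚ
      ft-nonneg : ∀ j → 0ℚ ≤ ft φ j
      ft-cap    : ∀ j → ft φ j ≤ costB j
      conserveA : ∀ i → fs φ i ≡ sumFin nB (λ j → fm φ i j)
      conserveB : ∀ j → sumFin nA (λ i → fm φ i j) ≡ ft φ j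

  value : Flow → ℚ
  value φ = sumFin nA (fs φ)

  IsMaxFlow : Prices → Flow → Set
  IsMaxFlow p φ = Feasible p φ × (∀ ψ → Feasible p ψ → value ψ ≤ value φ)

  data Arc : Node → Node → Set where
    fwd : ∀ {x y} → Edge x y → Arc x y
    bwd : ∀ {x y} → Edge x y → Arc y x

  data Walk : Node → Node → Set where
    []  : ∀ {u} → Walk u u
    _∷_ : ∀ {u v w} → Arc u v → Walk v w → Walk u w

  nodes : ∀ {u w} → Walk u w → List Node
  nodes {u} []      = u ∷ []
  nodes {u} (e ∷ P) = u ∷ nodes P

  IsPath : ∀ {u w} → Walk u w → Set
  IsPath P = Unique (nodes P)

  Residual : Prices → Flow → ∀ {x y} → Arc x y → Set
  Residual p φ (fwd (sa i))     = fs φ i < capA p i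
  Residual p φ (fwd (ab i j _)) = ⊤
  Residual p φ (fwd (bt j))     = ft φ j < costB j
  Residual p φ (bwd e)          = 0ℚ < flowOn φ e

  AllResidual : Prices → Flow → ∀ {u w} → Walk u w → Set
  AllResidual p φ []      = ⊤
  AllResidual p φ (e ∷ P) = Residual p φ e × AllResidual p φ P

  Augmenting : Prices → Flow → Walk s t → Set
  Augmenting p φ P = IsPath P × AllResidual p φ P

  PricePath : ∀ {w} → Walk s w → Set
  PricePath []             = ⊥
  PricePath (fwd (sa i) ∷ _) = T (priceable i)
  PricePath (bwd () ∷ _)

  ind : ∀ {n} → Fin n → Fin n → ℚ
  ind k k' = if ⌊ k ≟ k' ⌋ then 1ℚ else 0ℚ

  arcSA : ∀ {x y} → Arc x y → Fin nA → ℚ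
  arcSA (fwd (sa i))     i' = ind i i'
  arcSA (fwd (ab _ _ _)) i' = 0ℚ
  arcSA (fwd (bt _))     i' = 0ℚ
  arcSA (bwd (sa i))     i' = - ind i i'
  arcSA (bwd (ab _ _ _)) i' = 0ℚ
  arcSA (bwd (bt _))     i' = 0ℚ

  arcAB : ∀ {x y} → Arc x y → Fin nA → Fin nB → ℚ
  arcAB (fwd (sa _))     i' j' = 0ℚ
  arcAB (fwd (ab i j _)) i' j' = ind i i' * ind j j'
  arcAB (fwd (bt _))     i' j' = 0ℚ
  arcAB (bwd (sa _))     i' j' = 0ℚ
  arcAB (bwd (ab i j _)) i' j' = - (ind i i' * ind j j')
  arcAB (bwd (bt _))     i' j' = 0ℚ

  arcBT : ∀ {x y} → Arc x y → Fin nB → ℚ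
  arcBT (fwd (sa _))     j' = 0ℚ
  arcBT (fwd (ab _ _ _)) j' = 0ℚ
  arcBT (fwd (bt j))     j' = ind j j'
  arcBT (bwd (sa _))     j' = 0ℚ
  arcBT (bwd (ab _ _ _)) j' = 0ℚ
  arcBT (bwd (bt j))     j' = - ind j j'

  netSA : ∀ {u w} → Walk u w → Fin nA → ℚ
  netSA []      i = 0ℚ
  netSA (e ∷ P) i = arcSA e i + netSA P i

  netAB : ∀ {u w} → Walk u w → Fin nA → Fin nB → ℚ
  netAB []      i j = 0ℚ
  netAB (e ∷ P) i j = arcAB e i j + netAB P i j

  netBT : ∀ {u w} → Walk u w → Fin nB → ℚ
  netBT []      j = 0ℚ
  netBT (e ∷ P) j = arcBT e j + netBT P j

  augment : Flow → ℚ → ∀ {u w} → Walk u w → Flow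
  augment φ δ P = record
    { fs = λ i → fs φ i + δ * netSA P i
    ; fm = λ i j → fm φ i j + δ * netAB P i j
    ; ft = λ j → ft φ j + δ * netBT P j
    }

  -- One iteration of the while-loop (step (4)), from state (p, φ):
  -- v ∈ V_p; increasing p(v) (by δ > 0) yields the augmenting s-t-path P;
  -- p(v) and φ along P are increased by δ, where δ is as large as
  -- possible such that the resulting flow is feasible.
  record LoopStep (p : Prices) (φ : Flow) (v : Fin nA) (P : Walk s t) (δ : ℚ) : Set where
    field
      v-priceable : T (priceable v)
      δ-pos       : 0ℚ < δ
      augmenting  : Augmenting (raise p v δ) φ P
      feasible    : Feasible (raise p v δ) (augment φ δ P)
      maximal     : ∀ δ' → δ < δ' → ¬ Feasible (raise p v δ') (augment φ δ' P)

  -- States (prices, flow) reachable by the algorithm: after steps (1)-(3),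
  -- i.e. p = 0 and φ any maximum flow, followed by loop iterations.
  data Reachable : Prices → Flow → Set where
    init : ∀ φ → IsMaxFlow zeroPrices φ → Reachable zeroPrices φ
    step : ∀ {p φ v P δ} → Reachable p φ → LoopStep p φ v P δ →
           Reachable (raise p v δ) (augment φ δ P)

-- Call a walk s → a u → … → t with u ∉ V_p fixed if it never returns to s.  Whether a fixed
-- walk is augmenting does not depend on the prices: the only price-dependent capacities sit
-- on arcs leaving s.  The algorithm keeps the invariant that no fixed walk is augmenting.
-- Initially the flow is maximum, and augmenting a maximum flow by a small enough amount along
-- an augmenting walk would raise its value.  After an iteration along the path P, follow a
-- fixed augmenting walk Q of the new flow up to its first vertex on P and continue along P:
-- the arcs taken from Q leave vertices off P, so the augmentation did not give them their
-- residual capacity, and the spliced walk was a fixed augmenting walk already before.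
module Submission where

open import Defs
open import Algebra.Bundles using (CommutativeMonoid)
open import Data.Bool using (true; false; not; T; if_then_else_)
open import Data.Bool.Properties using (T-irrelevant)
open import Data.Empty using (⊥; ⊥-elim)
open import Data.Fin using (Fin; zero; suc; _≟_)
open import Data.Fin.Properties using (suc-injective)
import Data.List.Membership.DecPropositional as DecMembership
open import Data.List.Membership.Propositional using (_∈_; _∉_)
open import Data.List.Relation.Binary.Subset.Propositional using (_⊆_)
open import Data.List.Relation.Unary.Any using (here; there)
open import Data.List.Relation.Unary.Unique.Propositional.Properties using (Unique[x∷xs]⇒x∉xs)
open import Data.Nat using (ℕ)
open import Data.Product using (Σ-syntax; _×_; _,_; proj₁; proj₂)
open import Data.Rational
  using (ℚ; 0ℚ; 1ℚ; _+_; _*_; -_; _-_; _<_; _≤_; _⊓_; 1/_; Positive; NonZero; positive; nonNegative)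
import Data.Rational.Properties as ℚ
open import Data.Rational.Solver using (module +-*-Solver)
open import Data.Sum using (_⊎_; inj₁; inj₂; [_,_]′)
open import Data.Unit using (tt)
open import Function using (_∘_; id)
open import Relation.Binary.Definitions using (DecidableEquality)
open import Relation.Binary.PropositionalEquality
open import Relation.Nullary using (¬_; yes; no)
open import Relation.Nullary.Decidable using (map′; ⌊⌋-map′)

open import Algebra.Properties.CommutativeSemigroup
  (CommutativeMonoid.commutativeSemigroup ℚ.+-0-commutativeMonoid) using (interchange)
open import Algebra.Properties.Ring ℚ.+-*-ring using (-‿involutive; -‿distribʳ-*)
open +-*-Solver using (solve; _:+_; _:=_; :-_)

T-or-T-not : ∀ b → T b ⊎ T (not b)
T-or-T-not true  = inj₁ tt
T-or-T-not false = inj₂ tt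

T-not⇒¬T : ∀ {b} → T (not b) → ¬ T b
T-not⇒¬T {false} _ ()

0<1 : 0ℚ < 1ℚ
0<1 = ℚ.positive⁻¹ 1ℚ

0≤1 : 0ℚ ≤ 1ℚ
0≤1 = ℚ.<⇒≤ 0<1

p≤p+q : ∀ p {q} → 0ℚ ≤ q → p ≤ p + q
p≤p+q p 0≤q = subst (_≤ p + _) (ℚ.+-identityʳ p) (ℚ.+-monoʳ-≤ p 0≤q)

p+q≤p : ∀ p {q} → q ≤ 0ℚ → p + q ≤ p
p+q≤p p q≤0 = subst (p + _ ≤_) (ℚ.+-identityʳ p) (ℚ.+-monoʳ-≤ p q≤0)

0≤p*q : ∀ {p q} → 0ℚ ≤ p → 0ℚ ≤ q → 0ℚ ≤ p * q
0≤p*q {p} {q} 0≤p 0≤q =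
  ℚ.nonNegative⁻¹ (p * q) {{ℚ.nonNeg*nonNeg⇒nonNeg p {{nonNegative 0≤p}} q {{nonNegative 0≤q}}}}

p*q≤0 : ∀ {p q} → 0ℚ ≤ p → q ≤ 0ℚ → p * q ≤ 0ℚ
p*q≤0 {p} {q} 0≤p q≤0 =
  subst (p * q ≤_) (ℚ.*-zeroʳ p) (ℚ.*-monoˡ-≤-nonNeg p {{nonNegative 0≤p}} q≤0)

0<q-p : ∀ {p q} → p < q → 0ℚ < q - p
0<q-p {p} {q} p<q = subst (_< q - p) (ℚ.+-inverseʳ p) (ℚ.+-monoˡ-< (- p) p<q)

0≤p+q : ∀ {m p q} → m ≤ p → - m ≤ q → 0ℚ ≤ p + q
0≤p+q {m} m≤p -m≤q = subst (_≤ _) (ℚ.+-inverseʳ m) (ℚ.+-mono-≤ m≤p -m≤q)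

p+q≤r : ∀ {p q r} → q ≤ r - p → p + q ≤ r
p+q≤r {p} {q} {r} q≤r-p =
  subst (p + q ≤_) (solve 2 (λ p r → p :+ (r :+ (:- p)) := r) refl p r) (ℚ.+-monoʳ-≤ p q≤r-p)

telescope-step : ∀ p₁ p₂ x q₁ q₂ y z → p₁ + x ≡ q₁ + y → p₂ + y ≡ q₂ + z → (p₁ + p₂) + x ≡ (q₁ + q₂) + z
telescope-step p₁ p₂ x q₁ q₂ y z first rest = begin
  (p₁ + p₂) + x   ≡⟨ solve 3 (λ p₁ p₂ x → (p₁ :+ p₂) :+ x := (p₁ :+ x) :+ p₂) refl p₁ p₂ x ⟩
  (p₁ + x) + p₂   ≡⟨ cong (_+ p₂) first ⟩
  (q₁ + y) + p₂   ≡⟨ solve 3 (λ q₁ y p₂ → (q₁ :+ y) :+ p₂ := q₁ :+ (p₂ :+ y)) refl q₁ y p₂ ⟩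
  q₁ + (p₂ + y)   ≡⟨ cong (q₁ +_) rest ⟩
  q₁ + (q₂ + z)   ≡⟨ ℚ.+-assoc q₁ q₂ z ⟨
  (q₁ + q₂) + z   ∎
  where open ≡-Reasoning

module SmallMultiplier {m L : ℚ} (0<m : 0ℚ < m) (0≤L : 0ℚ ≤ L) where
  private
    D : ℚ
    D = 1ℚ + L

    L≤D : L ≤ D
    L≤D = subst (_≤ D) (ℚ.+-identityˡ L) (ℚ.+-monoˡ-≤ L 0≤1)

    instance
      D-positive : Positive D
      D-positive = positive (ℚ.+-mono-<-≤ 0<1 0≤L)
      D-nonZero : NonZero D
      D-nonZero = ℚ.pos⇒nonZero D

  ε : ℚ
  ε = m * 1/ D

  0<ε : 0ℚ < ε
  0<ε = ℚ.positive⁻¹ ε {{ℚ.pos*pos⇒pos m {{positive 0<m}} (1/ D) {{ℚ.1/pos⇒pos D}}}}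

  ε*≤ : ∀ {k} → k ≤ L → ε * k ≤ m
  ε*≤ {k} k≤L = begin
    ε * k          ≤⟨ ℚ.*-monoˡ-≤-nonNeg ε {{nonNegative (ℚ.<⇒≤ 0<ε)}} (ℚ.≤-trans k≤L L≤D) ⟩
    m * 1/ D * D   ≡⟨ ℚ.*-assoc m (1/ D) D ⟩
    m * (1/ D * D) ≡⟨ cong (m *_) (ℚ.*-inverseˡ D) ⟩
    m * 1ℚ         ≡⟨ ℚ.*-identityʳ m ⟩
    m              ∎
    where open ℚ.≤-Reasoning

  -m≤ε* : ∀ {k} → - L ≤ k → - m ≤ ε * k
  -m≤ε* {k} -L≤k = subst (- m ≤_) (trans (cong -_ (sym (-‿distribʳ-* ε k))) (-‿involutive (ε * k)))
    (ℚ.neg-antimono-≤ (ε*≤ (subst (- k ≤_) (-‿involutive L) (ℚ.neg-antimono-≤ -L≤k))))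

sumFin-cong : ∀ n {f g : Fin n → ℚ} → (∀ k → f k ≡ g k) → sumFin n f ≡ sumFin n g
sumFin-cong ℕ.zero    f≗g = refl
sumFin-cong (ℕ.suc n) f≗g = cong₂ _+_ (f≗g zero) (sumFin-cong n (f≗g ∘ suc))

sumFin-zero : ∀ n → sumFin n (λ _ → 0ℚ) ≡ 0ℚ
sumFin-zero ℕ.zero    = refl
sumFin-zero (ℕ.suc n) = cong (0ℚ +_) (sumFin-zero n)

sumFin-+ : ∀ n (f g : Fin n → ℚ) → sumFin n (λ k → f k + g k) ≡ sumFin n f + sumFin n g
sumFin-+ ℕ.zero    f g = refl
sumFin-+ (ℕ.suc n) f g =
  trans (cong (f zero + g zero +_) (sumFin-+ n (f ∘ suc) (g ∘ suc)))
        (interchange (f zero) (g zero) (sumFin n (f ∘ suc)) (sumFin n (g ∘ suc)))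

sumFin-*ˡ : ∀ n c (f : Fin n → ℚ) → sumFin n (λ k → c * f k) ≡ c * sumFin n f
sumFin-*ˡ ℕ.zero    c f = sym (ℚ.*-zeroʳ c)
sumFin-*ˡ (ℕ.suc n) c f =
  trans (cong (c * f zero +_) (sumFin-*ˡ n c (f ∘ suc)))
        (sym (ℚ.*-distribˡ-+ c (f zero) (sumFin n (f ∘ suc))))

sumFin-neg : ∀ n (f : Fin n → ℚ) → sumFin n (λ k → - f k) ≡ - sumFin n f
sumFin-neg ℕ.zero    f = refl
sumFin-neg (ℕ.suc n) f =
  trans (cong (- f zero +_) (sumFin-neg n (f ∘ suc)))
        (sym (ℚ.neg-distrib-+ (f zero) (sumFin n (f ∘ suc))))

module _ (G : Instance) where
  open Instance G

  private variable
    n : ℕ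
    u w x y x′ y′ : Node G
    p q : Prices G
    φ : Flow G
    δ : ℚ

  ind-cases : (k k′ : Fin n) → ind G k k′ ≡ 0ℚ ⊎ k ≡ k′
  ind-cases k k′ with k ≟ k′
  ... | yes k≡k′ = inj₂ k≡k′
  ... | no _     = inj₁ refl

  ind-refl : (k : Fin n) → ind G k k ≡ 1ℚ
  ind-refl k with k ≟ k
  ... | yes _  = refl
  ... | no k≢k = ⊥-elim (k≢k refl)

  ind-suc : (k k′ : Fin n) → ind G (suc k) (suc k′) ≡ ind G k k′
  ind-suc k k′ = cong (λ c → if c then 1ℚ else 0ℚ) (⌊⌋-map′ (cong suc) suc-injective (k ≟ k′))

  sumFin-ind : ∀ n (k : Fin n) → sumFin n (ind G k) ≡ 1ℚ
  sumFin-ind (ℕ.suc n) zero    = cong (1ℚ +_) (sumFin-zero n)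
  sumFin-ind (ℕ.suc n) (suc k) = cong (0ℚ +_) (trans (sumFin-cong n (ind-suc k)) (sumFin-ind n k))

  sumFin-*ind : ∀ n c (k : Fin n) → sumFin n (λ k′ → c * ind G k k′) ≡ c
  sumFin-*ind n c k =
    trans (sumFin-*ˡ n c (ind G k)) (trans (cong (c *_) (sumFin-ind n k)) (ℚ.*-identityʳ c))

  sumFin-ind* : ∀ n c (k : Fin n) → sumFin n (λ k′ → ind G k k′ * c) ≡ c
  sumFin-ind* n c k = trans (sumFin-cong n (λ k′ → ℚ.*-comm (ind G k k′) c)) (sumFin-*ind n c k)

  _≟ᴺ_ : DecidableEquality (Node G)
  s   ≟ᴺ s    = yes refl
  t   ≟ᴺ t    = yes refl
  a i ≟ᴺ a i′ = map′ (cong a) (λ { refl → refl }) (i ≟ i′)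
  b j ≟ᴺ b j′ = map′ (cong b) (λ { refl → refl }) (j ≟ j′)
  s   ≟ᴺ t    = no λ ()
  s   ≟ᴺ a _  = no λ ()
  s   ≟ᴺ b _  = no λ ()
  t   ≟ᴺ s    = no λ ()
  t   ≟ᴺ a _  = no λ ()
  t   ≟ᴺ b _  = no λ ()
  a _ ≟ᴺ s    = no λ ()
  a _ ≟ᴺ t    = no λ ()
  a _ ≟ᴺ b _  = no λ ()
  b _ ≟ᴺ s    = no λ ()
  b _ ≟ᴺ t    = no λ ()
  b _ ≟ᴺ a _  = no λ ()

  open DecMembership _≟ᴺ_ using (_∈?_)

  reverse : Arc G x y → Arc G y x
  reverse (fwd e) = bwd e
  reverse (bwd e) = fwd e

  data _∈ᵃ_ {x y : Node G} (r : Arc G x y) : {u w : Node G} → Walk G u w → Set where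
    here  : ∀ {w} {W : Walk G y w} → r ∈ᵃ (r ∷ W)
    there : ∀ {u v w} {r′ : Arc G u v} {W : Walk G v w} → r ∈ᵃ W → r ∈ᵃ (r′ ∷ W)

  start∈nodes : (W : Walk G u w) → u ∈ nodes G W
  start∈nodes []      = here refl
  start∈nodes (_ ∷ _) = here refl

  target∈nodes : {r : Arc G x y} {W : Walk G u w} → r ∈ᵃ W → y ∈ nodes G W
  target∈nodes {W = _ ∷ W} here      = there (start∈nodes W)
  target∈nodes (there r∈W)           = there (target∈nodes r∈W)

  suffixFrom : (W : Walk G u w) → x ∈ nodes G W → Walk G x w
  suffixFrom []      (here refl)  = []
  suffixFrom (r ∷ W) (here refl)  = r ∷ W
  suffixFrom (r ∷ W) (there x∈W) = suffixFrom W x∈W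

  suffixFrom-⊆ : (W : Walk G u w) (x∈W : x ∈ nodes G W) → nodes G (suffixFrom W x∈W) ⊆ nodes G W
  suffixFrom-⊆ []      (here refl)  = id
  suffixFrom-⊆ (r ∷ W) (here refl)  = id
  suffixFrom-⊆ (r ∷ W) (there x∈W) = there ∘ suffixFrom-⊆ W x∈W

  suffixFrom-residual : (W : Walk G u w) (x∈W : x ∈ nodes G W) →
                        AllResidual G p φ W → AllResidual G p φ (suffixFrom W x∈W)
  suffixFrom-residual []      (here refl)  _           = tt
  suffixFrom-residual (r ∷ W) (here refl)  res         = res
  suffixFrom-residual (r ∷ W) (there x∈W) (_ , W-res) = suffixFrom-residual W x∈W W-res

  lengthℚ : Walk G u w → ℚ
  lengthℚ []      = 0ℚ
  lengthℚ (_ ∷ W) = 1ℚ + lengthℚ W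

  0≤lengthℚ : (W : Walk G u w) → 0ℚ ≤ lengthℚ W
  0≤lengthℚ []      = ℚ.≤-refl
  0≤lengthℚ (_ ∷ W) = ℚ.+-mono-≤ 0≤1 (0≤lengthℚ W)

  data _≐_ {x y : Node G} (e : Edge G x y) : {x′ y′ : Node G} → Edge G x′ y′ → Set where
    same : e ≐ e

  arcCount : Arc G x′ y′ → Edge G x y → ℚ
  arcCount r (sa i)     = arcSA G r i
  arcCount r (ab i j _) = arcAB G r i j
  arcCount r (bt j)     = arcBT G r j

  netCount : Walk G u w → Edge G x y → ℚ
  netCount W (sa i)     = netSA G W i
  netCount W (ab i j _) = netAB G W i j
  netCount W (bt j)     = netBT G W j

  netCount-[] : (e : Edge G x y) → netCount ([] {u = u}) e ≡ 0ℚ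
  netCount-[] (sa _)     = refl
  netCount-[] (ab _ _ _) = refl
  netCount-[] (bt _)     = refl

  netCount-∷ : (r : Arc G u x′) (W : Walk G x′ w) (e : Edge G x y) →
               netCount (r ∷ W) e ≡ arcCount r e + netCount W e
  netCount-∷ r W (sa _)     = refl
  netCount-∷ r W (ab _ _ _) = refl
  netCount-∷ r W (bt _)     = refl

  flowOn-augment : (φ : Flow G) (δ : ℚ) (W : Walk G u w) (e : Edge G x y) →
                   flowOn G (augment G φ δ W) e ≡ flowOn G φ e + δ * netCount W e
  flowOn-augment φ δ W (sa _)     = refl
  flowOn-augment φ δ W (ab _ _ _) = refl
  flowOn-augment φ δ W (bt _)     = refl

  arcCount-fwd-cases : (e′ : Edge G x′ y′) (e : Edge G x y) → arcCount (fwd e′) e ≡ 0ℚ ⊎ e′ ≐ e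
  arcCount-fwd-cases (sa i) (sa i′) with ind-cases i i′
  ... | inj₁ ≡0   = inj₁ ≡0
  ... | inj₂ refl = inj₂ same
  arcCount-fwd-cases (ab i j e) (ab i′ j′ e′) with ind-cases i i′ | ind-cases j j′
  ... | inj₁ ≡0   | _         = inj₁ (trans (cong (_* ind G j j′) ≡0) (ℚ.*-zeroˡ (ind G j j′)))
  ... | inj₂ refl | inj₁ ≡0   = inj₁ (trans (cong (ind G i i *_) ≡0) (ℚ.*-zeroʳ (ind G i i)))
  ... | inj₂ refl | inj₂ refl = inj₂ (subst (λ e″ → ab i j e ≐ ab i j e″) (T-irrelevant e e′) same)
  arcCount-fwd-cases (bt j) (bt j′) with ind-cases j j′
  ... | inj₁ ≡0   = inj₁ ≡0
  ... | inj₂ refl = inj₂ same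
  arcCount-fwd-cases (sa _)     (ab _ _ _) = inj₁ refl
  arcCount-fwd-cases (sa _)     (bt _)     = inj₁ refl
  arcCount-fwd-cases (ab _ _ _) (sa _)     = inj₁ refl
  arcCount-fwd-cases (ab _ _ _) (bt _)     = inj₁ refl
  arcCount-fwd-cases (bt _)     (sa _)     = inj₁ refl
  arcCount-fwd-cases (bt _)     (ab _ _ _) = inj₁ refl

  arcCount-fwd-self : (e : Edge G x y) → arcCount (fwd e) e ≡ 1ℚ
  arcCount-fwd-self (sa i)     = ind-refl i
  arcCount-fwd-self (ab i j _) = cong₂ _*_ (ind-refl i) (ind-refl j)
  arcCount-fwd-self (bt j)     = ind-refl j

  arcCount-bwd : (e′ : Edge G x′ y′) (e : Edge G x y) → arcCount (bwd e′) e ≡ - arcCount (fwd e′) e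
  arcCount-bwd (sa _)     (sa _)     = refl
  arcCount-bwd (sa _)     (ab _ _ _) = refl
  arcCount-bwd (sa _)     (bt _)     = refl
  arcCount-bwd (ab _ _ _) (sa _)     = refl
  arcCount-bwd (ab _ _ _) (ab _ _ _) = refl
  arcCount-bwd (ab _ _ _) (bt _)     = refl
  arcCount-bwd (bt _)     (sa _)     = refl
  arcCount-bwd (bt _)     (ab _ _ _) = refl
  arcCount-bwd (bt _)     (bt _)     = refl

  arcCount-fwd-bounds : (e′ : Edge G x′ y′) (e : Edge G x y) →
                        0ℚ ≤ arcCount (fwd e′) e × arcCount (fwd e′) e ≤ 1ℚ
  arcCount-fwd-bounds e′ e with arcCount-fwd-cases e′ e
  ... | inj₁ ≡0   rewrite ≡0                   = ℚ.≤-refl , 0≤1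
  ... | inj₂ same rewrite arcCount-fwd-self e′ = 0≤1 , ℚ.≤-refl

  -1≤arcCount : (r : Arc G x′ y′) (e : Edge G x y) → - 1ℚ ≤ arcCount r e
  -1≤arcCount (fwd e′) e = ℚ.≤-trans (ℚ.neg-antimono-≤ 0≤1) (proj₁ (arcCount-fwd-bounds e′ e))
  -1≤arcCount (bwd e′) e rewrite arcCount-bwd e′ e = ℚ.neg-antimono-≤ (proj₂ (arcCount-fwd-bounds e′ e))

  arcCount≤1 : (r : Arc G x′ y′) (e : Edge G x y) → arcCount r e ≤ 1ℚ
  arcCount≤1 (fwd e′) e = proj₂ (arcCount-fwd-bounds e′ e)
  arcCount≤1 (bwd e′) e rewrite arcCount-bwd e′ e =
    ℚ.≤-trans (ℚ.neg-antimono-≤ (proj₁ (arcCount-fwd-bounds e′ e))) 0≤1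

  arcCount≤0 : (r : Arc G u x′) (W : Walk G x′ w) (e : Edge G x y) →
               arcCount r e ≤ 0ℚ ⊎ fwd e ∈ᵃ (r ∷ W)
  arcCount≤0 (fwd e′) W e with arcCount-fwd-cases e′ e
  ... | inj₁ ≡0   = inj₁ (ℚ.≤-reflexive ≡0)
  ... | inj₂ same = inj₂ here
  arcCount≤0 (bwd e′) W e rewrite arcCount-bwd e′ e =
    inj₁ (ℚ.neg-antimono-≤ (proj₁ (arcCount-fwd-bounds e′ e)))

  0≤arcCount : (r : Arc G u x′) (W : Walk G x′ w) (e : Edge G x y) →
               0ℚ ≤ arcCount r e ⊎ bwd e ∈ᵃ (r ∷ W)
  0≤arcCount (fwd e′) W e = inj₁ (proj₁ (arcCount-fwd-bounds e′ e))
  0≤arcCount (bwd e′) W e with arcCount-fwd-cases e′ e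
  ... | inj₁ ≡0   = inj₁ (ℚ.≤-reflexive (sym (trans (arcCount-bwd e′ e) (cong -_ ≡0))))
  ... | inj₂ same = inj₂ here

  netCount≤0 : (W : Walk G u w) (e : Edge G x y) → netCount W e ≤ 0ℚ ⊎ fwd e ∈ᵃ W
  netCount≤0 []      e = inj₁ (ℚ.≤-reflexive (netCount-[] e))
  netCount≤0 (r ∷ W) e with arcCount≤0 r W e | netCount≤0 W e
  ... | inj₂ e∈r∷W | _        = inj₂ e∈r∷W
  ... | inj₁ _     | inj₂ e∈W = inj₂ (there e∈W)
  ... | inj₁ r≤0   | inj₁ W≤0 = inj₁ (subst (_≤ 0ℚ) (sym (netCount-∷ r W e)) (ℚ.+-mono-≤ r≤0 W≤0))

  0≤netCount : (W : Walk G u w) (e : Edge G x y) → 0ℚ ≤ netCount W e ⊎ bwd e ∈ᵃ W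
  0≤netCount []      e = inj₁ (ℚ.≤-reflexive (sym (netCount-[] e)))
  0≤netCount (r ∷ W) e with 0≤arcCount r W e | 0≤netCount W e
  ... | inj₂ e∈r∷W | _        = inj₂ e∈r∷W
  ... | inj₁ _     | inj₂ e∈W = inj₂ (there e∈W)
  ... | inj₁ 0≤r   | inj₁ 0≤W = inj₁ (subst (0ℚ ≤_) (sym (netCount-∷ r W e)) (ℚ.+-mono-≤ 0≤r 0≤W))

  netCount≤lengthℚ : (W : Walk G u w) (e : Edge G x y) → netCount W e ≤ lengthℚ W
  netCount≤lengthℚ []      e = ℚ.≤-reflexive (netCount-[] e)
  netCount≤lengthℚ (r ∷ W) e rewrite netCount-∷ r W e =
    ℚ.+-mono-≤ (arcCount≤1 r e) (netCount≤lengthℚ W e)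

  -lengthℚ≤netCount : (W : Walk G u w) (e : Edge G x y) → - lengthℚ W ≤ netCount W e
  -lengthℚ≤netCount []      e = ℚ.≤-reflexive (sym (netCount-[] e))
  -lengthℚ≤netCount (r ∷ W) e rewrite netCount-∷ r W e | ℚ.neg-distrib-+ 1ℚ (lengthℚ W) =
    ℚ.+-mono-≤ (-1≤arcCount r e) (-lengthℚ≤netCount W e)

  augment-mono : 0ℚ ≤ δ → (W : Walk G u w) (e : Edge G x y) → 0ℚ ≤ netCount W e →
                 flowOn G φ e ≤ flowOn G (augment G φ δ W) e
  augment-mono {δ = δ} {φ = φ} 0≤δ W e 0≤n =
    subst (flowOn G φ e ≤_) (sym (flowOn-augment φ δ W e)) (p≤p+q _ (0≤p*q 0≤δ 0≤n))

  augment-antimono : 0ℚ ≤ δ → (W : Walk G u w) (e : Edge G x y) → netCount W e ≤ 0ℚ →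
                     flowOn G (augment G φ δ W) e ≤ flowOn G φ e
  augment-antimono {δ = δ} {φ = φ} 0≤δ W e n≤0 =
    subst (_≤ flowOn G φ e) (sym (flowOn-augment φ δ W e)) (p+q≤p _ (p*q≤0 0≤δ n≤0))

  -- Each arc-conservation law says that an arc changes the net flow at a node by the change of
  -- that node's indicator, with both sides moved so that no subtraction occurs.
  indA : Fin nA → Node G → ℚ
  indA i (a i′) = ind G i′ i
  indA i _      = 0ℚ

  indB : Fin nB → Node G → ℚ
  indB j (b j′) = ind G j′ j
  indB j _      = 0ℚ

  indS : Node G → ℚ
  indS s = 1ℚ
  indS _ = 0ℚ

  arc-conservationA : (r : Arc G x y) (i : Fin nA) →
                      arcSA G r i + indA i x ≡ sumFin nB (λ j → arcAB G r i j) + indA i y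
  arc-conservationA (fwd (sa i′)) i =
    trans (ℚ.+-comm (ind G i′ i) 0ℚ) (cong (_+ ind G i′ i) (sym (sumFin-zero nB)))
  arc-conservationA (fwd (ab i′ j′ _)) i =
    trans (ℚ.+-comm 0ℚ (ind G i′ i)) (cong (_+ 0ℚ) (sym (sumFin-*ind nB (ind G i′ i) j′)))
  arc-conservationA (fwd (bt _)) i = cong (_+ 0ℚ) (sym (sumFin-zero nB))
  arc-conservationA (bwd (sa i′)) i =
    trans (ℚ.+-inverseˡ (ind G i′ i)) (cong (_+ 0ℚ) (sym (sumFin-zero nB)))
  arc-conservationA (bwd (ab i′ j′ _)) i = sym (begin
    sumFin nB (λ j → - (ind G i′ i * ind G j′ j)) + ind G i′ i
      ≡⟨ cong (_+ ind G i′ i) (sumFin-neg nB (λ j → ind G i′ i * ind G j′ j)) ⟩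
    - sumFin nB (λ j → ind G i′ i * ind G j′ j) + ind G i′ i
      ≡⟨ cong (λ c → - c + ind G i′ i) (sumFin-*ind nB (ind G i′ i) j′) ⟩
    - ind G i′ i + ind G i′ i
      ≡⟨ ℚ.+-inverseˡ (ind G i′ i) ⟩
    0ℚ ∎)
    where open ≡-Reasoning
  arc-conservationA (bwd (bt _)) i = cong (_+ 0ℚ) (sym (sumFin-zero nB))

  arc-conservationB : (r : Arc G x y) (j : Fin nB) →
                      sumFin nA (λ i → arcAB G r i j) + indB j x ≡ arcBT G r j + indB j y
  arc-conservationB (fwd (sa _)) j = cong (_+ 0ℚ) (sumFin-zero nA)
  arc-conservationB (fwd (ab i′ j′ _)) j =
    trans (cong (_+ 0ℚ) (sumFin-ind* nA (ind G j′ j) i′)) (ℚ.+-comm (ind G j′ j) 0ℚ)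
  arc-conservationB (fwd (bt j′)) j =
    trans (cong (_+ ind G j′ j) (sumFin-zero nA)) (ℚ.+-comm 0ℚ (ind G j′ j))
  arc-conservationB (bwd (sa _)) j = cong (_+ 0ℚ) (sumFin-zero nA)
  arc-conservationB (bwd (ab i′ j′ _)) j = begin
    sumFin nA (λ i → - (ind G i′ i * ind G j′ j)) + ind G j′ j
      ≡⟨ cong (_+ ind G j′ j) (sumFin-neg nA (λ i → ind G i′ i * ind G j′ j)) ⟩
    - sumFin nA (λ i → ind G i′ i * ind G j′ j) + ind G j′ j
      ≡⟨ cong (λ c → - c + ind G j′ j) (sumFin-ind* nA (ind G j′ j) i′) ⟩
    - ind G j′ j + ind G j′ j
      ≡⟨ ℚ.+-inverseˡ (ind G j′ j) ⟩
    0ℚ ∎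
    where open ≡-Reasoning
  arc-conservationB (bwd (bt j′)) j =
    trans (cong (_+ 0ℚ) (sumFin-zero nA)) (sym (ℚ.+-inverseˡ (ind G j′ j)))

  arc-conservationS : (r : Arc G x y) → 0ℚ + indS x ≡ sumFin nA (λ i → arcSA G r i) + indS y
  arc-conservationS (fwd (sa i′)) = sym (cong (_+ 0ℚ) (sumFin-ind nA i′))
  arc-conservationS (fwd (ab _ _ _)) = sym (cong (_+ 0ℚ) (sumFin-zero nA))
  arc-conservationS (fwd (bt _)) = sym (cong (_+ 0ℚ) (sumFin-zero nA))
  arc-conservationS (bwd (sa i′)) = sym (begin
    sumFin nA (λ i → - ind G i′ i) + 1ℚ ≡⟨ cong (_+ 1ℚ) (sumFin-neg nA (ind G i′)) ⟩
    - sumFin nA (ind G i′) + 1ℚ          ≡⟨ cong (λ c → - c + 1ℚ) (sumFin-ind nA i′) ⟩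
    - 1ℚ + 1ℚ                            ≡⟨⟩
    0ℚ                                   ∎)
    where open ≡-Reasoning
  arc-conservationS (bwd (ab _ _ _)) = sym (cong (_+ 0ℚ) (sumFin-zero nA))
  arc-conservationS (bwd (bt _)) = sym (cong (_+ 0ℚ) (sumFin-zero nA))

  module Telescope
    (F H : ∀ {u w} → Walk G u w → ℚ) (f h : ∀ {x y} → Arc G x y → ℚ) (π : Node G → ℚ)
    (F-[] : ∀ {u} → F ([] {u = u}) ≡ H ([] {u = u}))
    (F-∷ : ∀ {u v w} (r : Arc G u v) (W : Walk G v w) → F (r ∷ W) ≡ f r + F W)
    (H-∷ : ∀ {u v w} (r : Arc G u v) (W : Walk G v w) → H (r ∷ W) ≡ h r + H W)
    (arc-law : ∀ {x y} (r : Arc G x y) → f r + π x ≡ h r + π y)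
    where

    telescope : (W : Walk G u w) → F W + π u ≡ H W + π w
    telescope {u} []                        = cong (_+ π u) F-[]
    telescope {u} {w} (_∷_ {v = v} r W) = begin
      F (r ∷ W) + π u   ≡⟨ cong (_+ π u) (F-∷ r W) ⟩
      (f r + F W) + π u ≡⟨ telescope-step (f r) (F W) (π u) (h r) (H W) (π v) (π w)
                             (arc-law r) (telescope W) ⟩
      (h r + H W) + π w ≡⟨ cong (_+ π w) (H-∷ r W) ⟨
      H (r ∷ W) + π w   ∎
      where open ≡-Reasoning

  walk-conservationA : (W : Walk G s t) (i : Fin nA) → netSA G W i ≡ sumFin nB (λ j → netAB G W i j)
  walk-conservationA W i =
    trans (sym (ℚ.+-identityʳ _)) (trans (telescope W) (ℚ.+-identityʳ _))
    where
      open Telescope (λ V → netSA G V i) (λ V → sumFin nB (λ j → netAB G V i j))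
                     (λ r → arcSA G r i) (λ r → sumFin nB (λ j → arcAB G r i j)) (indA i)
                     (sym (sumFin-zero nB)) (λ r V → refl)
                     (λ r V → sumFin-+ nB (λ j → arcAB G r i j) (λ j → netAB G V i j))
                     (λ r → arc-conservationA r i)

  walk-conservationB : (W : Walk G s t) (j : Fin nB) → sumFin nA (λ i → netAB G W i j) ≡ netBT G W j
  walk-conservationB W j =
    trans (sym (ℚ.+-identityʳ _)) (trans (telescope W) (ℚ.+-identityʳ _))
    where
      open Telescope (λ V → sumFin nA (λ i → netAB G V i j)) (λ V → netBT G V j)
                     (λ r → sumFin nA (λ i → arcAB G r i j)) (λ r → arcBT G r j) (indB j)
                     (sumFin-zero nA)
                     (λ r V → sumFin-+ nA (λ i → arcAB G r i j) (λ i → netAB G V i j)) (λ r V → refl)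
                     (λ r → arc-conservationB r j)

  walk-value : (W : Walk G s t) → sumFin nA (netSA G W) ≡ 1ℚ
  walk-value W = sym (trans (telescope W) (ℚ.+-identityʳ _))
    where
      open Telescope (λ _ → 0ℚ) (λ V → sumFin nA (netSA G V))
                     (λ _ → 0ℚ) (λ r → sumFin nA (λ i → arcSA G r i)) indS (sym (sumFin-zero nA)) (λ r V → refl)
                     (λ r V → sumFin-+ nA (λ i → arcSA G r i) (netSA G V)) arc-conservationS

  augment-conserveA : (W : Walk G s t) (i : Fin nA) → fs φ i ≡ sumFin nB (fm φ i) →
                      fs (augment G φ δ W) i ≡ sumFin nB (fm (augment G φ δ W) i)
  augment-conserveA {φ = φ} {δ = δ} W i conserved = begin
    fs φ i + δ * netSA G W i
      ≡⟨ cong₂ (λ c d → c + δ * d) conserved (walk-conservationA W i) ⟩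
    sumFin nB (fm φ i) + δ * sumFin nB (λ j → netAB G W i j)
      ≡⟨ cong (sumFin nB (fm φ i) +_) (sumFin-*ˡ nB δ (λ j → netAB G W i j)) ⟨
    sumFin nB (fm φ i) + sumFin nB (λ j → δ * netAB G W i j)
      ≡⟨ sumFin-+ nB (fm φ i) (λ j → δ * netAB G W i j) ⟨
    sumFin nB (λ j → fm φ i j + δ * netAB G W i j) ∎
    where open ≡-Reasoning

  augment-conserveB : (W : Walk G s t) (j : Fin nB) → sumFin nA (λ i → fm φ i j) ≡ ft φ j →
                      sumFin nA (λ i → fm (augment G φ δ W) i j) ≡ ft (augment G φ δ W) j
  augment-conserveB {φ = φ} {δ = δ} W j conserved = begin
    sumFin nA (λ i → fm φ i j + δ * netAB G W i j)
      ≡⟨ sumFin-+ nA (λ i → fm φ i j) (λ i → δ * netAB G W i j) ⟩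
    sumFin nA (λ i → fm φ i j) + sumFin nA (λ i → δ * netAB G W i j)
      ≡⟨ cong (sumFin nA (λ i → fm φ i j) +_) (sumFin-*ˡ nA δ (λ i → netAB G W i j)) ⟩
    sumFin nA (λ i → fm φ i j) + δ * sumFin nA (λ i → netAB G W i j)
      ≡⟨ cong₂ (λ c d → c + δ * d) conserved (walk-conservationB W j) ⟩
    ft φ j + δ * netBT G W j ∎
    where open ≡-Reasoning

  augment-value : (W : Walk G s t) → value G (augment G φ δ W) ≡ value G φ + δ
  augment-value {φ = φ} {δ = δ} W = begin
    sumFin nA (λ i → fs φ i + δ * netSA G W i)
      ≡⟨ sumFin-+ nA (fs φ) (λ i → δ * netSA G W i) ⟩
    value G φ + sumFin nA (λ i → δ * netSA G W i)
      ≡⟨ cong (value G φ +_) (sumFin-*ˡ nA δ (netSA G W)) ⟩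
    value G φ + δ * sumFin nA (netSA G W)
      ≡⟨ cong (λ c → value G φ + δ * c) (walk-value W) ⟩
    value G φ + δ * 1ℚ
      ≡⟨ cong (value G φ +_) (ℚ.*-identityʳ δ) ⟩
    value G φ + δ ∎
    where open ≡-Reasoning

  arcAB-nonedge : ∀ {i j} (r : Arc G x y) → T (not (edge i j)) → arcAB G r i j ≡ 0ℚ
  arcAB-nonedge {i = i} {j} (fwd (ab i′ j′ e)) ¬e with ind-cases i′ i | ind-cases j′ j
  ... | inj₁ ≡0   | _         = trans (cong (_* ind G j′ j) ≡0) (ℚ.*-zeroˡ (ind G j′ j))
  ... | inj₂ refl | inj₁ ≡0   = trans (cong (ind G i′ i′ *_) ≡0) (ℚ.*-zeroʳ (ind G i′ i′))
  ... | inj₂ refl | inj₂ refl = ⊥-elim (T-not⇒¬T ¬e e)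
  arcAB-nonedge (bwd (ab i′ j′ e)) ¬e = cong -_ (arcAB-nonedge (fwd (ab i′ j′ e)) ¬e)
  arcAB-nonedge (fwd (sa _)) _ = refl
  arcAB-nonedge (fwd (bt _)) _ = refl
  arcAB-nonedge (bwd (sa _)) _ = refl
  arcAB-nonedge (bwd (bt _)) _ = refl

  augment-nonedge : ∀ {i j} (W : Walk G u w) → T (not (edge i j)) → fm (augment G φ δ W) i j ≡ fm φ i j
  augment-nonedge {φ = φ} {δ = δ} {i} {j} W ¬e =
    trans (cong (λ c → fm φ i j + δ * c) (netAB≡0 W))
          (trans (cong (fm φ i j +_) (ℚ.*-zeroʳ δ)) (ℚ.+-identityʳ (fm φ i j)))
    where
      netAB≡0 : (V : Walk G x y) → netAB G V i j ≡ 0ℚ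
      netAB≡0 []      = refl
      netAB≡0 (r ∷ V) = cong₂ _+_ (arcAB-nonedge r ¬e) (netAB≡0 V)

  slack : Prices G → Flow G → Arc G x y → ℚ
  slack p φ (fwd (sa i))     = capA G p i - fs φ i
  slack p φ (fwd (ab _ _ _)) = 1ℚ
  slack p φ (fwd (bt j))     = costB j - ft φ j
  slack p φ (bwd e)          = flowOn G φ e

  0<slack : (r : Arc G x y) → Residual G p φ r → 0ℚ < slack p φ r
  0<slack (fwd (sa _))     = 0<q-p
  0<slack (fwd (ab _ _ _)) = λ _ → 0<1
  0<slack (fwd (bt _))     = 0<q-p
  0<slack (bwd _)          = id

  minSlack : Prices G → Flow G → Walk G u w → ℚ
  minSlack p φ []      = 1ℚ
  minSlack p φ (r ∷ W) = slack p φ r ⊓ minSlack p φ W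

  0<minSlack : (W : Walk G u w) → AllResidual G p φ W → 0ℚ < minSlack p φ W
  0<minSlack []      _ = 0<1
  0<minSlack {p = p} {φ = φ} (r ∷ W) (r-res , W-res) with ℚ.⊓-sel (slack p φ r) (minSlack p φ W)
  ... | inj₁ ≡slack = subst (0ℚ <_) (sym ≡slack) (0<slack r r-res)
  ... | inj₂ ≡min   = subst (0ℚ <_) (sym ≡min) (0<minSlack W W-res)

  minSlack≤slack : {r : Arc G x y} {W : Walk G u w} → r ∈ᵃ W → minSlack p φ W ≤ slack p φ r
  minSlack≤slack {p = p} {φ = φ} {r = r} {W = _ ∷ W} here = ℚ.p⊓q≤p (slack p φ r) (minSlack p φ W)
  minSlack≤slack {p = p} {φ = φ} {W = r′ ∷ W} (there r∈W) =
    ℚ.≤-trans (ℚ.p⊓q≤q (slack p φ r′) (minSlack p φ W)) (minSlack≤slack r∈W)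

  -- ε = minSlack / (1 + length Q) is small enough: an edge is traversed at most length Q times
  -- net, so augmenting by ε overshoots the slack of no arc of Q.
  module SlackAugmentation {p : Prices G} {φ : Flow G} (Q : Walk G s t) (Q-res : AllResidual G p φ Q)
    where
    open SmallMultiplier (0<minSlack Q Q-res) (0≤lengthℚ Q) public

    ψ : Flow G
    ψ = augment G φ ε Q

    ψ-nonneg : (e : Edge G x y) → 0ℚ ≤ flowOn G φ e → 0ℚ ≤ flowOn G ψ e
    ψ-nonneg e 0≤φe with 0≤netCount Q e
    ... | inj₁ 0≤n    = ℚ.≤-trans 0≤φe (augment-mono (ℚ.<⇒≤ 0<ε) Q e 0≤n)
    ... | inj₂ bwd∈Q = subst (0ℚ ≤_) (sym (flowOn-augment φ ε Q e))
                         (0≤p+q (minSlack≤slack bwd∈Q) (-m≤ε* (-lengthℚ≤netCount Q e)))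

    ψ-≤ : (e : Edge G x y) {c : ℚ} → flowOn G φ e ≤ c →
          (fwd e ∈ᵃ Q → minSlack p φ Q ≤ c - flowOn G φ e) → flowOn G ψ e ≤ c
    ψ-≤ e φe≤c slack-bound with netCount≤0 Q e
    ... | inj₁ n≤0    = ℚ.≤-trans (augment-antimono (ℚ.<⇒≤ 0<ε) Q e n≤0) φe≤c
    ... | inj₂ fwd∈Q = subst (_≤ _) (sym (flowOn-augment φ ε Q e))
                         (p+q≤r (ℚ.≤-trans (ε*≤ (netCount≤lengthℚ Q e)) (slack-bound fwd∈Q)))

    ψ-feasible : Feasible G p φ → Feasible G p ψ
    ψ-feasible feasible = record
      { fs-nonneg  = λ i → ψ-nonneg (sa i) (fs-nonneg i)
      ; fs-cap     = λ i → ψ-≤ (sa i) (fs-cap i) (minSlack≤slack {p = p} {φ = φ})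
      ; fm-nonneg  = ψ-fm-nonneg
      ; fm-nonedge = λ i j ¬e → trans (augment-nonedge {φ = φ} {δ = ε} Q ¬e) (fm-nonedge i j ¬e)
      ; ft-nonneg  = λ j → ψ-nonneg (bt j) (ft-nonneg j)
      ; ft-cap     = λ j → ψ-≤ (bt j) (ft-cap j) (minSlack≤slack {p = p} {φ = φ})
      ; conserveA  = λ i → augment-conserveA {φ = φ} {δ = ε} Q i (conserveA i)
      ; conserveB  = λ j → augment-conserveB {φ = φ} {δ = ε} Q j (conserveB j)
      }
      where
        open Feasible feasible
        ψ-fm-nonneg : ∀ i j → 0ℚ ≤ fm ψ i j
        ψ-fm-nonneg i j with T-or-T-not (edge i j)
        ... | inj₁ e  = ψ-nonneg (ab i j e) (fm-nonneg i j)
        ... | inj₂ ¬e = subst (0ℚ ≤_) (sym (augment-nonedge {φ = φ} {δ = ε} Q ¬e)) (fm-nonneg i j)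

  maxFlow⇒¬augmentingWalk : IsMaxFlow G p φ → (Q : Walk G s t) → ¬ AllResidual G p φ Q
  maxFlow⇒¬augmentingWalk {φ = φ} (feasible , maximal) Q Q-res = ℚ.<-irrefl refl (begin-strict
    value G φ      ≡⟨ ℚ.+-identityʳ (value G φ) ⟨
    value G φ + 0ℚ <⟨ ℚ.+-monoʳ-< (value G φ) 0<ε ⟩
    value G φ + ε  ≡⟨ augment-value {φ = φ} {δ = ε} Q ⟨
    value G ψ      ≤⟨ maximal ψ (ψ-feasible feasible) ⟩
    value G φ      ∎)
    where
      open SlackAugmentation Q Q-res
      open ℚ.≤-Reasoning

  NoFixedAugmentingWalk : Flow G → Set
  NoFixedAugmentingWalk φ = ∀ p u → T (not (priceable u)) → (W : Walk G (a u) t) →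
                            s ∉ nodes G W → ¬ AllResidual G p φ (fwd (sa u) ∷ W)

  residual-reprice : (r : Arc G x y) → x ≢ s → Residual G p φ r → Residual G q φ r
  residual-reprice (fwd (sa _))     x≢s = ⊥-elim (x≢s refl)
  residual-reprice (fwd (ab _ _ _)) _   = id
  residual-reprice (fwd (bt _))     _   = id
  residual-reprice (bwd _)          _   = id

  allResidual-reprice : (W : Walk G u w) → s ∉ nodes G W → AllResidual G p φ W → AllResidual G q φ W
  allResidual-reprice []      _   _               = tt
  allResidual-reprice (r ∷ W) s∉W (r-res , W-res) =
    residual-reprice r (λ { refl → s∉W (here refl) }) r-res , allResidual-reprice W (s∉W ∘ there) W-res

  capA-fixed : ∀ {u} → T (not (priceable u)) → capA G p u ≡ costA u
  capA-fixed {u = u} fixed with priceable u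
  ... | false = refl

  fixedWalk-reprice : ∀ {u} → T (not (priceable u)) → (W : Walk G (a u) t) → s ∉ nodes G W →
                      AllResidual G p φ (fwd (sa u) ∷ W) → AllResidual G q φ (fwd (sa u) ∷ W)
  fixedWalk-reprice {p = p} {φ = φ} {q = q} {u = u} fixed W s∉W (first , rest) =
    subst (fs φ u <_) (trans (capA-fixed {p = p} fixed) (sym (capA-fixed {p = q} fixed))) first ,
    allResidual-reprice W s∉W rest

  maxFlow⇒noFixedAugmentingWalk : IsMaxFlow G (zeroPrices G) φ → NoFixedAugmentingWalk φ
  maxFlow⇒noFixedAugmentingWalk maxFlow p u fixed W s∉W res =
    maxFlow⇒¬augmentingWalk maxFlow (fwd (sa u) ∷ W) (fixedWalk-reprice fixed W s∉W res)

  residual-before-augment : 0ℚ ≤ δ → (P : Walk G u w) (r : Arc G x y) → ¬ reverse r ∈ᵃ P →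
                            Residual G p (augment G φ δ P) r → Residual G p φ r
  residual-before-augment {φ = φ} 0≤δ P (fwd (sa i)) bwd∉P =
    ℚ.≤-<-trans (augment-mono {φ = φ} 0≤δ P (sa i) ([ id , ⊥-elim ∘ bwd∉P ]′ (0≤netCount P (sa i))))
  residual-before-augment 0≤δ P (fwd (ab _ _ _)) _ = id
  residual-before-augment {φ = φ} 0≤δ P (fwd (bt j)) bwd∉P =
    ℚ.≤-<-trans (augment-mono {φ = φ} 0≤δ P (bt j) ([ id , ⊥-elim ∘ bwd∉P ]′ (0≤netCount P (bt j))))
  residual-before-augment {φ = φ} 0≤δ P (bwd e) fwd∉P res =
    ℚ.<-≤-trans res (augment-antimono {φ = φ} 0≤δ P e ([ id , ⊥-elim ∘ fwd∉P ]′ (netCount≤0 P e)))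

  -- P = r₀ ∷ P′ is the path of a loop iteration, with P′ avoiding s.
  module Splice {p : Prices G} {φ : Flow G} {δ : ℚ} {x₀} {r₀ : Arc G s x₀} {P′ : Walk G x₀ t}
                (0≤δ : 0ℚ ≤ δ) (P′-res : AllResidual G p φ P′) (s∉P′ : s ∉ nodes G P′) where

    splice : (Q : Walk G x t) → s ∉ nodes G Q → AllResidual G p (augment G φ δ (r₀ ∷ P′)) Q →
             Σ[ W ∈ Walk G x t ] (s ∉ nodes G W × AllResidual G p φ W)
    splice []      s∉Q _ = [] , s∉Q , tt
    splice {x = x} (r ∷ Q) s∉Q (r-res , Q-res) with x ∈? nodes G P′
    ... | yes x∈P′ =
      suffixFrom P′ x∈P′ , s∉P′ ∘ suffixFrom-⊆ P′ x∈P′ , suffixFrom-residual P′ x∈P′ P′-res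
    ... | no  x∉P′ = extend (splice Q (s∉Q ∘ there) Q-res)
      where
        reverse-r∉P : ¬ reverse r ∈ᵃ (r₀ ∷ P′)
        reverse-r∉P r∈P with target∈nodes r∈P
        ... | here x≡s    = s∉Q (here (sym x≡s))
        ... | there x∈P′ = x∉P′ x∈P′

        extend : Σ[ W ∈ Walk G _ t ] (s ∉ nodes G W × AllResidual G p φ W) →
                 Σ[ W ∈ Walk G x t ] (s ∉ nodes G W × AllResidual G p φ W)
        extend (W , s∉W , W-res) =
          r ∷ W ,
          (λ { (here s≡x) → s∉Q (here s≡x) ; (there s∈W) → s∉W s∈W }) ,
          residual-before-augment 0≤δ (r₀ ∷ P′) r reverse-r∉P r-res , W-res

  loopStep-preserves : ∀ {v P} → NoFixedAugmentingWalk φ → LoopStep G p φ v P δ →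
                       NoFixedAugmentingWalk (augment G φ δ P)
  loopStep-preserves {φ = φ} {p = p} {δ = δ} {v = v} {P = r₀ ∷ P′} noFixed loop q u fixed W s∉W res =
    conclude (splice W s∉W (allResidual-reprice W s∉W (proj₂ res)))
    where
      open LoopStep loop
      p′ = raise G p v δ
      0≤δ = ℚ.<⇒≤ δ-pos
      s∉P′ = Unique[x∷xs]⇒x∉xs (proj₁ augmenting)
      open Splice {r₀ = r₀} 0≤δ (proj₂ (proj₂ augmenting)) s∉P′

      bwd-sa∉P : ¬ bwd (sa u) ∈ᵃ (r₀ ∷ P′)
      bwd-sa∉P (there r∈P′) = s∉P′ (target∈nodes r∈P′)

      first : fs φ u < capA G p′ u
      first = residual-before-augment {p = p′} {φ = φ} 0≤δ (r₀ ∷ P′) (fwd (sa u)) bwd-sa∉P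
                (proj₁ (fixedWalk-reprice {q = p′} fixed W s∉W res))

      conclude : Σ[ W₀ ∈ Walk G (a u) t ] (s ∉ nodes G W₀ × AllResidual G p′ φ W₀) → ⊥
      conclude (W₀ , s∉W₀ , W₀-res) = noFixed p′ u fixed W₀ s∉W₀ (first , W₀-res)

  reachable⇒noFixedAugmentingWalk : Reachable G p φ → NoFixedAugmentingWalk φ
  reachable⇒noFixedAugmentingWalk (init φ maxFlow) = maxFlow⇒noFixedAugmentingWalk maxFlow
  reachable⇒noFixedAugmentingWalk (step reach loop) =
    loopStep-preserves (reachable⇒noFixedAugmentingWalk reach) loop

  augmenting⇒pricePath : {P : Walk G s t} → NoFixedAugmentingWalk φ → Augmenting G p φ P → PricePath G P
  augmenting⇒pricePath {P = bwd () ∷ _}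
  augmenting⇒pricePath {p = p} {P = fwd (sa i) ∷ P′} noFixed (path , res) with T-or-T-not (priceable i)
  ... | inj₁ priceable-i = priceable-i
  ... | inj₂ fixed-i     = ⊥-elim (noFixed p i fixed-i P′ (Unique[x∷xs]⇒x∉xs path) res)

lemma4p2 : (G : Instance) → ∀ {p φ v P δ} → Reachable G p φ → LoopStep G p φ v P δ → PricePath G P
lemma4p2 G reach loop =
  augmenting⇒pricePath G (reachable⇒noFixedAugmentingWalk G reach) (LoopStep.augmenting loop)
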